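{- Let $A$ be a commutative ring with identity and $HA$ the ring of Hurwitz series over $A$. Let $n\in\mathbb{N}^+$ be fixed and $u_0,\dots,u_{n-1}\in HA$. Then for every $m\in\mathbb{N}$, $$\int^m\mathrm{intl}(u_0,\dots,u_{n-1})=\mathrm{intl}\Big(\int^{\widehat{m}+1}u_{n-\overline{m}},\ \dots,\ \int^{\widehat{m}+1}u_{n-1},\ \int^{\widehat{m}}u_0,\ \dots,\ \int^{\widehat{m}}u_{n-\overline{m}-1}\Big),$$ where $\widehat{m}=\lfloor m/n\rfloor$ and $\overline{m}=m-\widehat{m}n$.
   Context: $HA$ is the set of sequences $f=(f(0),f(1),\dots)$ with entries in $A$, with componentwise addition and product $(fg)(m)=\sum_{i=0}^m\binom{m}{i}f(i)g(m-i)$. The integral is $\int f=(0,f(0),f(1),\dots)$ and $\int^m$ its $m$-fold iterate ($\int^0=\mathrm{id}$). For fixed $n$, $\widehat{q}=\lfloor q/n\rfloor$, $\overline{q}=q-\widehat{q}n$; the interlacing is $\mathrm{intl}(u_0,\dots,u_{n-1})(q)=u_{\overline{q}}(\widehat{q})$, i.e. $(u_0(0),\dots,u_{n-1}(0),u_0(1),\dots,u_{n-1}(1),\dots)$. -}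

module Defs where

open import Level using (Level)
open import Algebra.Bundles using (CommutativeRing)
open import Data.Nat using (ℕ; zero; suc; _+_; _*_; _∸_; _<_; _≤_; _<?_; NonZero)
open import Data.Nat.Properties using (+-monoˡ-<; m+[n∸m]≡n; m∸n≤m; ≤-<-trans; <⇒≤)
open import Data.Nat.DivMod using (_/_; _%_; m%n<n)
open import Data.Nat.Combinatorics using (_C_)
open import Data.Fin using (Fin; toℕ; fromℕ<)
open import Data.Fin.Properties using (toℕ<n)
open import Relation.Nullary using (yes; no)
open import Relation.Binary.PropositionalEquality using (subst)

module Hurwitz {c ℓ : Level} (A : CommutativeRing c ℓ) where
  open CommutativeRing A using (Carrier; _≈_; 0#) renaming (_+_ to _+ᴬ_; _*_ to _*ᴬ_)

  HA : Set c
  HA = ℕ → Carrier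

  infix 4 _≋_
  _≋_ : HA → HA → Set ℓ
  f ≋ g = ∀ q → f q ≈ g q

  _·_ : ℕ → Carrier → Carrier
  zero · a = 0#
  suc k · a = a +ᴬ (k · a)

  _⊕_ : HA → HA → HA
  (f ⊕ g) q = f q +ᴬ g q

  private
    conv : ℕ → HA → HA → ℕ → Carrier
    conv m f g zero = (m C 0) · (f 0 *ᴬ g m)
    conv m f g (suc k) = conv m f g k +ᴬ (m C suc k) · (f (suc k) *ᴬ g (m ∸ suc k))

  _⊛_ : HA → HA → HA
  (f ⊛ g) m = conv m f g m

  ∫ : HA → HA
  ∫ f zero = 0#
  ∫ f (suc q) = f q

  ∫^ : ℕ → HA → HA
  ∫^ zero f = f
  ∫^ (suc m) f = ∫ (∫^ m f)

  intl : (n : ℕ) .{{_ : NonZero n}} → (Fin n → HA) → HA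
  intl n u q = u (fromℕ< (m%n<n q n)) (q / n)

  private
    bound₁ : ∀ {j r n} → j < r → r ≤ n → j + (n ∸ r) < n
    bound₁ {j} {r} {n} j<r r≤n =
      subst (j + (n ∸ r) <_) (m+[n∸m]≡n r≤n) (+-monoˡ-< (n ∸ r) j<r)

    bound₂ : ∀ {j n} r → j < n → j ∸ r < n
    bound₂ {j} r j<n = ≤-<-trans (m∸n≤m j r) j<n

  -- the right-hand side family of Proposition 2.8:
  -- (∫^{m̂+1} u_{n-m̄}, …, ∫^{m̂+1} u_{n-1}, ∫^{m̂} u_0, …, ∫^{m̂} u_{n-m̄-1})
  -- where m̂ = ⌊m/n⌋, m̄ = m mod n; entry j is
  --   ∫^{m̂+1} u_{n-m̄+j}  if j < m̄,   ∫^{m̂} u_{j-m̄}  otherwise.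
  shiftedFamily : (n : ℕ) .{{_ : NonZero n}} → (Fin n → HA) → ℕ → Fin n → HA
  shiftedFamily n u m j with toℕ j <? m % n
  ... | yes j<m̄ = ∫^ (suc (m / n))
                     (u (fromℕ< (bound₁ j<m̄ (<⇒≤ (m%n<n m n)))))
  ... | no _    = ∫^ (m / n) (u (fromℕ< (bound₂ (m % n) (toℕ<n j))))

-- Write q = j + k n with j < n.  Entry j of the family on the right is ∫^e u_i
-- with m + i = j + e n.  If k < e this relation puts q below m, so both sides
-- vanish; if k = e + p it gives q = m + (i + p n), so ∫^m intl(u) at q is
-- intl(u) at i + p n, which is u_i(p) = (∫^e u_i)(k).
module Submission where

open import Defs
open import Level using (Level)
open import Algebra.Bundles using (CommutativeRing)
open import Data.Nat using (ℕ; zero; suc; NonZero; _+_; _*_; _∸_; _<_; _<?_; s≤s)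
open import Data.Nat.Properties
  using (+-assoc; +-comm; +-monoʳ-≤; +-monoʳ-<; *-monoˡ-≤; +-cancelʳ-<; m+[n∸m]≡n; <⇒≤; ≮⇒≥)
open import Data.Nat.DivMod
  using (_/_; _%_; _mod_; _divMod_; DivMod; m%n<n; m≡m%n+[m/n]*n; [m+kn]%n≡m%n; m<n⇒m%n≡m;
         +-distrib-/-∣ʳ; m<n⇒m/n≡0; m*n/n≡m)
open import Data.Nat.Divisibility using (divides-refl)
open import Data.Nat.Solver using (module +-*-Solver)
open import Data.Fin using (Fin; toℕ; fromℕ<)
open import Data.Fin.Properties using (toℕ<n; toℕ-fromℕ<; toℕ-injective)
open import Data.Product using (Σ-syntax; _×_; _,_)
open import Relation.Nullary using (yes; no)
open import Relation.Binary.PropositionalEquality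

private
  open +-*-Solver

  rotate-+ : ∀ a b d n j → a + b * n + (j + d) ≡ j + (a + d + b * n)
  rotate-+ = solve 5 (λ a b d n j → a :+ b :* n :+ (j :+ d) := j :+ (a :+ d :+ b :* n)) refl

  swap-+ : ∀ a b d n → a + b * n + d ≡ a + d + b * n
  swap-+ = solve 4 (λ a b d n → a :+ b :* n :+ d := a :+ d :+ b :* n) refl

  split-+ : ∀ j e p n → j + (e + p) * n ≡ j + e * n + p * n
  split-+ = solve 4 (λ j e p n → j :+ (e :+ p) :* n := j :+ e :* n :+ p :* n) refl

module _ {c ℓ : Level} (A : CommutativeRing c ℓ) where
  open Hurwitz A
  open CommutativeRing A using (0#)

  ∫^-apply-+ : ∀ m (f : HA) r → ∫^ m f (m + r) ≡ f r
  ∫^-apply-+ zero    f r = refl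
  ∫^-apply-+ (suc m) f r = ∫^-apply-+ m f r

  ∫^-apply-< : ∀ {m q} (f : HA) → q < m → ∫^ m f q ≡ 0#
  ∫^-apply-< {suc m} {zero}  f _         = refl
  ∫^-apply-< {suc m} {suc q} f (s≤s q<m) = ∫^-apply-< f q<m

  module _ (n : ℕ) .{{_ : NonZero n}} where

    intl-apply : ∀ (v : Fin n → HA) (i : Fin n) k → intl n v (toℕ i + k * n) ≡ v i k
    intl-apply v i k = cong₂ v (toℕ-injective mod-eq) div-eq
      where
      mod-eq : toℕ ((toℕ i + k * n) mod n) ≡ toℕ i
      mod-eq = trans (toℕ-fromℕ< _) (trans ([m+kn]%n≡m%n (toℕ i) k n) (m<n⇒m%n≡m (toℕ<n i)))
      div-eq : (toℕ i + k * n) / n ≡ k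
      div-eq = trans (+-distrib-/-∣ʳ (toℕ i) (divides-refl k))
                     (cong₂ _+_ (m<n⇒m/n≡0 (toℕ<n i)) (m*n/n≡m k n))

    ∫^-intl : ∀ (u : Fin n → HA) m e (i j : Fin n) → m + toℕ i ≡ toℕ j + e * n →
              ∀ k → ∫^ m (intl n u) (toℕ j + k * n) ≡ ∫^ e (u i) k
    ∫^-intl u m e i j shift k with k <? e
    ... | yes k<e = trans (∫^-apply-< (intl n u) below) (sym (∫^-apply-< (u i) k<e))
      where
      below : toℕ j + k * n < m
      below = +-cancelʳ-< n (toℕ j + k * n) m (begin-strict
        toℕ j + k * n + n   ≡⟨ +-assoc (toℕ j) (k * n) n ⟩
        toℕ j + (k * n + n) ≡⟨ cong (toℕ j +_) (+-comm (k * n) n) ⟩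
        toℕ j + suc k * n   ≤⟨ +-monoʳ-≤ (toℕ j) (*-monoˡ-≤ n k<e) ⟩
        toℕ j + e * n       ≡⟨ shift ⟨
        m + toℕ i           <⟨ +-monoʳ-< m (toℕ<n i) ⟩
        m + n               ∎)
        where open Data.Nat.Properties.≤-Reasoning
    ... | no k≮e = begin
      ∫^ m (intl n u) (toℕ j + k * n)       ≡⟨ cong (λ k → ∫^ m (intl n u) (toℕ j + k * n)) e+p≡k ⟨
      ∫^ m (intl n u) (toℕ j + (e + p) * n) ≡⟨ cong (∫^ m (intl n u)) above ⟩
      ∫^ m (intl n u) (m + (toℕ i + p * n)) ≡⟨ ∫^-apply-+ m (intl n u) (toℕ i + p * n) ⟩
      intl n u (toℕ i + p * n)              ≡⟨ intl-apply u i p ⟩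
      u i p                                 ≡⟨ ∫^-apply-+ e (u i) p ⟨
      ∫^ e (u i) (e + p)                    ≡⟨ cong (∫^ e (u i)) e+p≡k ⟩
      ∫^ e (u i) k                          ∎
      where
      open ≡-Reasoning
      p = k ∸ e
      e+p≡k : e + p ≡ k
      e+p≡k = m+[n∸m]≡n (≮⇒≥ k≮e)
      above : toℕ j + (e + p) * n ≡ m + (toℕ i + p * n)
      above = begin
        toℕ j + (e + p) * n       ≡⟨ split-+ (toℕ j) e p n ⟩
        toℕ j + e * n + p * n     ≡⟨ cong (_+ p * n) shift ⟨
        m + toℕ i + p * n         ≡⟨ +-assoc m (toℕ i) (p * n) ⟩
        m + (toℕ i + p * n)       ∎

    shiftedFamily-shift : ∀ (u : Fin n → HA) m (j : Fin n) →
      Σ[ e ∈ ℕ ] Σ[ i ∈ Fin n ] (m + toℕ i ≡ toℕ j + e * n × shiftedFamily n u m j ≡ ∫^ e (u i))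
    shiftedFamily-shift u m j with toℕ j <? m % n
    ... | yes j<m%n = suc (m / n) , fromℕ< _ , shift , refl
      where
      open ≡-Reasoning
      shift : m + toℕ (fromℕ< _) ≡ toℕ j + suc (m / n) * n
      shift = begin
        m + toℕ (fromℕ< _)                        ≡⟨ cong₂ _+_ (m≡m%n+[m/n]*n m n) (toℕ-fromℕ< _) ⟩
        m % n + m / n * n + (toℕ j + (n ∸ m % n)) ≡⟨ rotate-+ (m % n) (m / n) (n ∸ m % n) n (toℕ j) ⟩
        toℕ j + (m % n + (n ∸ m % n) + m / n * n) ≡⟨ cong (λ x → toℕ j + (x + m / n * n))
                                                          (m+[n∸m]≡n (<⇒≤ (m%n<n m n))) ⟩
        toℕ j + suc (m / n) * n                   ∎
    ... | no j≮m%n = m / n , fromℕ< _ , shift , refl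
      where
      open ≡-Reasoning
      shift : m + toℕ (fromℕ< _) ≡ toℕ j + m / n * n
      shift = begin
        m + toℕ (fromℕ< _)                ≡⟨ cong₂ _+_ (m≡m%n+[m/n]*n m n) (toℕ-fromℕ< _) ⟩
        m % n + m / n * n + (toℕ j ∸ m % n) ≡⟨ swap-+ (m % n) (m / n) (toℕ j ∸ m % n) n ⟩
        m % n + (toℕ j ∸ m % n) + m / n * n ≡⟨ cong (_+ m / n * n) (m+[n∸m]≡n (≮⇒≥ j≮m%n)) ⟩
        toℕ j + m / n * n                 ∎

proposition2p8 : ∀ {c ℓ : Level} (A : CommutativeRing c ℓ) (n : ℕ) .{{_ : NonZero n}}
    (u : Fin n → Hurwitz.HA A) (m : ℕ) →
    Hurwitz._≋_ A (Hurwitz.∫^ A m (Hurwitz.intl A n u))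
    (Hurwitz.intl A n (Hurwitz.shiftedFamily A n u m))
proposition2p8 A n u m q with shiftedFamily-shift A n u m (q mod n)
... | e , i , shift , family≡ = reflexive (begin
  ∫^ m (intl n u) q                             ≡⟨ cong (∫^ m (intl n u)) (DivMod.property (q divMod n)) ⟩
  ∫^ m (intl n u) (toℕ (q mod n) + q / n * n)   ≡⟨ ∫^-intl A n u m e i (q mod n) shift (q / n) ⟩
  ∫^ e (u i) (q / n)                            ≡⟨ cong-app family≡ (q / n) ⟨
  shiftedFamily n u m (q mod n) (q / n)         ∎)
  where open Hurwitz A
        open CommutativeRing A using (reflexive)
        open ≡-Reasoning
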